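{- Let $n\ge 2$ be an integer, $k=n-1$, and consider the game $SN(n,k)$. For a position $\mathbf p$ let $s=\Sigma(\mathbf p)\bmod 2k$ (taken in $\{0,1,\dots,2k-1\}$) and let $o$ be the number of indices $i$ with $p_i$ odd. Then for every position $s$ and $o$ have the same parity. Moreover, a reduced position $\mathbf p$ is a P-position of $SN(n,k)$ if and only if its pair $(s,o)$ belongs to $S_1\cup S_2\cup S_3$, where $S_1=\{(s,o): s\equiv o \pmod 2,\ 0\le s<k-1,\ o\le s\}$, $S_2=\{(n-2,o): o\equiv n \pmod 2\}$, $S_3=\{(s,o): s\equiv o\pmod 2,\ k-1<s<2k-1,\ o\le 2(k-1)-s\}$.
   Context: For an integer $n\ge 1$ and a nonempty set $A\subseteq\{1,\dots,n\}$, the game $SN(n,A)$ (Slow SetNim) is played on $n$ stacks of tokens; a position is $\mathbf p=(p_1,\dots,p_n)$ of nonnegative integers ($p_i$ is the height of stack $i$), written in non-decreasing order so that $p_n=\max_i p_i$; stacks of height $0$ still count as stacks. A move consists of choosing some $\ell\in A$ and $\ell$ distinct stacks, each of height at least $1$, and removing exactly one token from each chosen stack. Players alternate; a player unable to move loses (normal play). A P-position is one from which the player to move loses under optimal play; an N-position is one from which the player to move wins. $SN(n,k)$ denotes $SN(n,\{k\})$, and $\Sigma(\mathbf p)=\sum_i p_i$. A terminal position is one with no legal move. For a position $\mathbf p$, let $\mathcal T(\mathbf p)$ be the set of terminal positions reachable from $\mathbf p$ by finite sequences of legal moves, let $u_i(\mathbf p)=\min\{t_i:\mathbf t\in\mathcal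 T(\mathbf p)\}$, and define the reduction $r(\mathbf p)=\mathbf p-u(\mathbf p)$. The position $\mathbf p$ is reduced if $r(\mathbf p)=\mathbf p$ (equivalently, for every $i$ some terminal position reachable from $\mathbf p$ has its $i$-th stack equal to $0$). -}

module Defs where

open import Data.Nat using (ℕ; zero; suc; _+_; _*_; _∸_; _≤_; _<_; _%_)
open import Data.Fin using (Fin)
open import Data.Fin.Subset using (Subset; _∈_; _∉_; ∣_∣)
open import Data.Nat.ListAction using (sum)
open import Data.List using (List; map; allFin; filter; length)
open import Data.Nat.Properties using (_≟_)
open import Data.Product using (Σ; ∃; _×_; _,_)
open import Data.Empty using (⊥)
open import Relation.Nullary using (¬_)
open import Relation.Binary.PropositionalEquality using (_≡_)
open import Relation.Binary.Construct.Closure.ReflexiveTransitive using (Star)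

-- A position of SN(n,A): the stack heights, indexed by Fin n.
-- (The paper's non-decreasing ordering is only a presentation convention.)
Position : ℕ → Set
Position n = Fin n → ℕ

record Move {n : ℕ} (A : ℕ → Set) (p q : Position n) : Set where
  constructor move
  field
    chosen   : Subset n
    inA      : A ∣ chosen ∣
    nonempty : ∀ i → i ∈ chosen → 1 ≤ p i
    takeOne  : ∀ i → i ∈ chosen → q i ≡ p i ∸ 1
    keep     : ∀ i → i ∉ chosen → q i ≡ p i

-- P- and N-positions under normal play (inductively: the game is finite).
mutual
  data IsP {n : ℕ} (A : ℕ → Set) (p : Position n) : Set where
    isP : (∀ q → Move A p q → IsN A q) → IsP A p

  data IsN {n : ℕ} (A : ℕ → Set) (p : Position n) : Set where
    isN : ∀ q → Move A p q → IsP A q → IsN A p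

Terminal : {n : ℕ} (A : ℕ → Set) → Position n → Set
Terminal A p = ∀ q → ¬ Move A p q

Reachable : {n : ℕ} (A : ℕ → Set) → Position n → Position n → Set
Reachable A = Star (Move A)

-- p is reduced: r(p) = p, i.e. u_i(p) = min{ t_i : t ∈ T(p) } = 0 for all i,
-- i.e. for every i some reachable terminal position has i-th stack 0.
Reduced : {n : ℕ} (A : ℕ → Set) → Position n → Set
Reduced A p = ∀ i → ∃ λ t → Reachable A p t × Terminal A t × t i ≡ 0

Single : ℕ → ℕ → Set
Single k ℓ = ℓ ≡ k

Σp : {n : ℕ} → Position n → ℕ
Σp {n} p = sum (map p (allFin n))

oddCount : {n : ℕ} → Position n → ℕ
oddCount {n} p = length (filter (λ i → p i % 2 ≟ 1) (allFin n))

S₁ : ℕ → ℕ → ℕ → Set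
S₁ k s o = (s % 2 ≡ o % 2) × (s < k ∸ 1) × (o ≤ s)

S₂ : ℕ → ℕ → ℕ → Set
S₂ n s o = (s ≡ n ∸ 2) × (o % 2 ≡ n % 2)

S₃ : ℕ → ℕ → ℕ → Set
S₃ k s o = (s % 2 ≡ o % 2) × (k ∸ 1 < s) × (s < 2 * k ∸ 1) × (o ≤ 2 * (k ∸ 1) ∸ s)

-- a mod d, for d ≥ 1 (the result for d = 0 is irrelevant: only used with d = 2k ≥ 2)
_modP_ : ℕ → ℕ → ℕ
a modP zero    = a
a modP (suc d) = a % suc d

sOf : {n : ℕ} → ℕ → Position n → ℕ
sOf k p = Σp p modP (2 * k)

-- A move of SN(n, n − 1) lowers every stack but one. Write k = n − 1 and clip L p = Σᵢ min (pᵢ, L),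
-- and say that p has level L and excess F when clip L p = k·L + F and clip (L + 1) p < k·(L + 1).
-- Whether p is a P-position depends only on L mod 2, F, and the number o of odd entries of
-- min (p, L) (the predicate Losing). This is proved for all positions at once, by induction on Σ p:
-- skipping stack j leads to level L − 1 with the same excess if pⱼ < L, to level L − 1 with excess
-- F − 1 if pⱼ ≥ L and F > 0, and to level L − 2 if pⱼ ≥ L and F = 0, and in each case the new odd
-- count is tied to o by a linear relation; a case analysis then shows that no move preserves Losing,
-- while from any other position some move reaches it. A reduced position has k·pᵢ ≤ Σ p for all i,
-- so it equals its own clip at L = Σ p div k, with F = Σ p mod k, and s = F + k·(L mod 2) turns
-- Losing into S₁ ∪ S₂ ∪ S₃.

module Submission where

open import Defs
open import Data.Nat using (ℕ; zero; suc; _+_; _*_; _∸_; _≤_; _<_; z≤n; s≤s; _⊓_; _≤?_; _≟_; parity)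
open import Data.Nat.Properties
open import Data.Nat.DivMod using (_/_; _%_; m≡m%n+[m/n]*n; m%n<n; [m+kn]%n≡m%n; [m+n]%n≡m%n; m<n⇒m%n≡m; m∣n⇒o%n%m≡o%m)
open import Data.Nat.Divisibility using (divides)
open import Data.Nat.Induction using (<-wellFounded)
open import Data.Nat.Tactic.RingSolver using (solve-∀)
import Data.Nat.ListAction as List
open import Data.Parity.Base as ℙ using (Parity; 0ℙ; 1ℙ)
import Data.Parity.Properties as ℙ
open import Data.Fin using (Fin; zero; suc; punchIn; punchOut)
open import Data.Fin.Properties using (any?; punchInᵢ≢i; punchIn-punchOut) renaming (_≟_ to _≟ᶠ_)
open import Data.Fin.Subset using (Subset; _∈_; _∉_; ∣_∣; ∁; ⁅_⁆; inside; outside)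
open import Data.Fin.Subset.Properties
  using (∣p∣≡n⇒p≡⊤; ∈⊤; ∣∁p∣≡n∸∣p∣; ∣⁅x⁆∣≡1; x∈⁅y⁆⇒x≡y; x∈⁅x⁆; _∈?_; x∈∁p⇒x∉p; x∉∁p⇒x∈p)
open import Data.Vec.Base using (_∷_; here; there)
open import Data.List using (tabulate; map; filter; length)
open import Data.List.Properties using (filter-accept; filter-reject)
open import Data.Product using (∃; _×_; _,_; proj₁; proj₂)
open import Data.Sum using (_⊎_; inj₁; inj₂)
open import Function using (_∘_)
open import Function.Bundles using (_⇔_; mk⇔)
open import Relation.Nullary using (¬_; Dec; yes; no; contradiction)
open import Relation.Nullary.Decidable using (_×-dec_; _⊎-dec_)
open import Relation.Binary.PropositionalEquality
open import Relation.Binary.Construct.Closure.ReflexiveTransitive using (ε; _◅_)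
import Relation.Binary.Construct.On as On
import Induction.WellFounded as WF
open import Algebra.Properties.Semiring.Sum +-*-semiring
  using (sum; sum-cong-≗; ∑-distrib-+; *-distribˡ-sum; sum-remove)

sum-const : ∀ n c → sum {n} (λ _ → c) ≡ n * c
sum-const zero    c = refl
sum-const (suc n) c = cong (c +_) (sum-const n c)

sum-ones : ∀ {n} {f : Fin n → ℕ} → (∀ i → f i ≡ 1) → sum f ≡ n
sum-ones {n} f≡1 = trans (sum-cong-≗ f≡1) (trans (sum-const n 1) (*-identityʳ n))

sum-suc : ∀ {n} (f : Fin n → ℕ) → sum (suc ∘ f) ≡ sum f + n
sum-suc {zero}  f = refl
sum-suc {suc n} f = trans (cong (λ s → suc (f zero + s)) (sum-suc (f ∘ suc))) (shuffle (f zero) _ n)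
  where
  shuffle : ∀ a b c → suc (a + (b + c)) ≡ a + b + suc c
  shuffle = solve-∀

sum-mono-≤ : ∀ {n} {f g : Fin n → ℕ} → (∀ i → f i ≤ g i) → sum f ≤ sum g
sum-mono-≤ {zero}  f≤g = z≤n
sum-mono-≤ {suc n} f≤g = +-mono-≤ (f≤g zero) (sum-mono-≤ (λ i → f≤g (suc i)))

term≤sum : ∀ {n} (f : Fin n → ℕ) i → f i ≤ sum f
term≤sum f zero    = m≤m+n _ _
term≤sum f (suc i) = ≤-trans (term≤sum (λ i → f (suc i)) i) (m≤n+m _ _)

sum≤n : ∀ {n} {f : Fin n → ℕ} → (∀ i → f i ≤ 1) → sum f ≤ n
sum≤n {n} f≤1 = ≤-trans (sum-mono-≤ f≤1) (≤-reflexive (trans (sum-const n 1) (*-identityʳ n)))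

sum-differ-at : ∀ {n} (j : Fin (suc n)) {f g : Fin (suc n) → ℕ} {a b : ℕ} →
  (∀ i → i ≢ j → f i ≡ g i) → f j + a ≡ g j + b → sum f + a ≡ sum g + b
sum-differ-at j {f} {g} {a} {b} f≡g fj+a≡gj+b = begin
  sum f + a                       ≡⟨ cong (_+ a) (sum-remove f) ⟩
  f j + sum (f ∘ punchIn j) + a   ≡⟨ swap (f j) _ a ⟩
  f j + a + sum (f ∘ punchIn j)   ≡⟨ cong₂ _+_ fj+a≡gj+b (sum-cong-≗ (λ k → f≡g _ (punchInᵢ≢i j k))) ⟩
  g j + b + sum (g ∘ punchIn j)   ≡⟨ sym (swap (g j) _ b) ⟩
  g j + sum (g ∘ punchIn j) + b   ≡⟨ cong (_+ b) (sym (sum-remove g)) ⟩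
  sum g + b                       ∎
  where
  open ≡-Reasoning
  swap : ∀ x y z → x + y + z ≡ x + z + y
  swap = solve-∀

sum-lowered : ∀ {n} (j : Fin (suc n)) {f g : Fin (suc n) → ℕ} →
  (∀ i → i ≢ j → suc (f i) ≡ g i) → sum f + suc n + g j ≡ sum g + suc (f j)
sum-lowered {n} j {f} {g} lowered = begin
  sum f + suc n + g j  ≡⟨ cong (_+ g j) (sum-suc f) ⟨
  sum (suc ∘ f) + g j  ≡⟨ sum-differ-at j lowered (+-comm (suc (f j)) (g j)) ⟩
  sum g + suc (f j)    ∎
  where open ≡-Reasoning

sum≤n-zeroAt : ∀ {n} {f : Fin (suc n) → ℕ} → (∀ i → f i ≤ 1) → ∀ z → f z ≡ 0 → sum f ≤ n
sum≤n-zeroAt {n} {f} f≤1 z fz≡0 = begin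
  sum f                      ≡⟨ sum-remove f ⟩
  f z + sum (f ∘ punchIn z)  ≡⟨ cong (_+ sum (f ∘ punchIn z)) fz≡0 ⟩
  sum (f ∘ punchIn z)        ≤⟨ sum≤n (f≤1 ∘ punchIn z) ⟩
  n                          ∎
  where open ≤-Reasoning

sum≤n-zeroAt₂ : ∀ {n} {f : Fin (suc (suc n)) → ℕ} → (∀ i → f i ≤ 1) →
  ∀ z w → z ≢ w → f z ≡ 0 → f w ≡ 0 → sum f ≤ n
sum≤n-zeroAt₂ {n} {f} f≤1 z w z≢w fz≡0 fw≡0 = begin
  sum f                      ≡⟨ sum-remove f ⟩
  f z + sum (f ∘ punchIn z)  ≡⟨ cong (_+ sum (f ∘ punchIn z)) fz≡0 ⟩
  sum (f ∘ punchIn z)        ≤⟨ sum≤n-zeroAt (f≤1 ∘ punchIn z) (punchOut z≢w)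
                                   (trans (cong f (punchIn-punchOut z≢w)) fw≡0) ⟩
  n                          ∎
  where open ≤-Reasoning

toℕ : Parity → ℕ
toℕ 0ℙ = 0
toℕ 1ℙ = 1

toℕ-injective : ∀ {a b} → toℕ a ≡ toℕ b → a ≡ b
toℕ-injective {0ℙ} {0ℙ} _ = refl
toℕ-injective {1ℙ} {1ℙ} _ = refl

ℙ-+-transpose : ∀ {a b c} → a ℙ.+ b ≡ c → a ≡ c ℙ.+ b
ℙ-+-transpose {0ℙ} {0ℙ} refl = refl
ℙ-+-transpose {0ℙ} {1ℙ} refl = refl
ℙ-+-transpose {1ℙ} {0ℙ} refl = refl
ℙ-+-transpose {1ℙ} {1ℙ} refl = refl

parity-suc : ∀ x → parity (suc x) ≡ parity x ℙ.⁻¹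
parity-suc x = trans (sym (ℙ.⁻¹-involutive (parity (suc x)))) (cong ℙ._⁻¹ (ℙ.suc-homo-⁻¹ x))

parity-suc-≡ : ∀ x {λ′} → parity x ≡ λ′ → parity (suc x) ≡ λ′ ℙ.⁻¹
parity-suc-≡ x x≡λ′ = trans (parity-suc x) (cong ℙ._⁻¹ x≡λ′)

parity-suc⁻¹ : ∀ x {λ′} → parity (suc x) ≡ λ′ → parity x ≡ λ′ ℙ.⁻¹
parity-suc⁻¹ x sx≡λ′ =
  trans (sym (ℙ.⁻¹-involutive (parity x))) (cong ℙ._⁻¹ (trans (sym (parity-suc x)) sx≡λ′))

parity-2*+ : ∀ b a → parity (2 * b + a) ≡ parity a
parity-2*+ b a = trans (ℙ.+-homo-+ (2 * b) a) (cong (ℙ._+ parity a) (ℙ.*-homo-* 2 b))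

parity-gap : ∀ {x y} → parity x ≡ parity y → y < x → suc (suc y) ≤ x
parity-gap {x} {y} x≡y y<x with m≤n⇒m<n∨m≡n y<x
... | inj₁ 1+y<x = 1+y<x
... | inj₂ refl  = contradiction (trans (sym x≡y) (parity-suc y)) (ℙ.p≢p⁻¹ (parity y))

bit : ℕ → ℕ
bit = toℕ ∘ parity

bit≤1 : ∀ x → bit x ≤ 1
bit≤1 x with parity x
... | 0ℙ = z≤n
... | 1ℙ = s≤s z≤n

bit≢1⇒bit≡0 : ∀ x → bit x ≢ 1 → bit x ≡ 0
bit≢1⇒bit≡0 x b≢1 with parity x
... | 0ℙ = refl
... | 1ℙ = contradiction refl b≢1

bit≢0⇒bit≡1 : ∀ x → bit x ≢ 0 → bit x ≡ 1
bit≢0⇒bit≡1 x b≢0 with parity x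
... | 0ℙ = contradiction refl b≢0
... | 1ℙ = refl

bit-suc : ∀ x → bit (suc x) + bit x ≡ 1
bit-suc zero          = refl
bit-suc (suc zero)    = refl
bit-suc (suc (suc x)) = bit-suc x

%2≡bit : ∀ x → x % 2 ≡ bit x
%2≡bit zero          = refl
%2≡bit (suc zero)    = refl
%2≡bit (suc (suc x)) = trans (cong (_% 2) (+-comm 2 x)) (trans ([m+n]%n≡m%n x 2) (%2≡bit x))

parity-bit : ∀ x → parity (bit x) ≡ parity x
parity-bit x with parity x
... | 0ℙ = refl
... | 1ℙ = refl

parity-sum-bit : ∀ {n} (f : Fin n → ℕ) → parity (sum (bit ∘ f)) ≡ parity (sum f)
parity-sum-bit {zero}  f = refl
parity-sum-bit {suc n} f = begin
  parity (bit (f zero) + sum (bit ∘ f ∘ suc))          ≡⟨ ℙ.+-homo-+ (bit (f zero)) _ ⟩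
  parity (bit (f zero)) ℙ.+ parity (sum (bit ∘ f ∘ suc)) ≡⟨ cong₂ ℙ._+_ (parity-bit (f zero)) (parity-sum-bit (f ∘ suc)) ⟩
  parity (f zero) ℙ.+ parity (sum (f ∘ suc))           ≡⟨ ℙ.+-homo-+ (f zero) _ ⟨
  parity (f zero + sum (f ∘ suc))                      ∎
  where open ≡-Reasoning

listSum-tabulate : ∀ {n m} (f : Fin n → Fin m) (g : Fin m → ℕ) →
  List.sum (map g (tabulate f)) ≡ sum (g ∘ f)
listSum-tabulate {zero}  f g = refl
listSum-tabulate {suc n} f g = cong (g (f zero) +_) (listSum-tabulate (f ∘ suc) g)

length-filter-odd : ∀ {n m} (f : Fin n → Fin m) (g : Fin m → ℕ) →
  length (filter (λ i → g i % 2 Data.Nat.≟ 1) (tabulate f)) ≡ sum (bit ∘ g ∘ f)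
length-filter-odd {zero}  f g = refl
length-filter-odd {suc n} f g with g (f zero) % 2 Data.Nat.≟ 1 | %2≡bit (g (f zero))
... | yes odd  | %2≡b = trans (cong length (filter-accept odd?  odd))
  (cong₂ _+_ (trans (sym odd) %2≡b) (length-filter-odd (f ∘ suc) g))
  where odd? = λ i → g i % 2 Data.Nat.≟ 1
... | no  even | %2≡b = trans (cong length (filter-reject odd? even)) (trans (length-filter-odd (f ∘ suc) g)
  (cong (_+ sum (bit ∘ g ∘ f ∘ suc)) (sym (bit≢1⇒bit≡0 (g (f zero)) (even ∘ trans %2≡b)))))
  where odd? = λ i → g i % 2 Data.Nat.≟ 1

Σp≡sum : ∀ {n} (p : Position n) → Σp p ≡ sum p
Σp≡sum p = listSum-tabulate (λ i → i) p

oddCount≡sum-bit : ∀ {n} (p : Position n) → oddCount p ≡ sum (bit ∘ p)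
oddCount≡sum-bit p = length-filter-odd (λ i → i) p

record Skip {n} (j : Fin n) (p q : Position n) : Set where
  field
    lower : ∀ i → i ≢ j → suc (q i) ≡ p i
    keep  : q j ≡ p j

one-missing : ∀ k (S : Subset (suc k)) → ∣ S ∣ ≡ k → ∃ λ j → j ∉ S × (∀ i → i ∉ S → i ≡ j)
one-missing k (outside ∷ S) ∣S∣≡k with ∣p∣≡n⇒p≡⊤ {p = S} ∣S∣≡k
... | refl = zero , (λ ()) , λ { zero _ → refl ; (suc i) i∉S → contradiction (there ∈⊤) i∉S }
one-missing (suc k) (inside ∷ S) ∣S∣≡k with one-missing k S (suc-injective ∣S∣≡k)
... | j , j∉S , unique = suc j , (λ { (there j∈S) → j∉S j∈S }) , λ
  { zero i∉S → contradiction here i∉S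
  ; (suc i) i∉S → cong suc (unique i (λ i∈S → i∉S (there i∈S))) }

move⇒skip : ∀ {k} {p q : Position (suc k)} → Move (Single k) p q → ∃ λ j → Skip j p q
move⇒skip {k} {p} {q} (move S ∣S∣≡k nonempty takeOne keep) with one-missing k S ∣S∣≡k
... | j , j∉S , unique = j , record { lower = lower ; keep = keep j j∉S }
  where
  lower : ∀ i → i ≢ j → suc (q i) ≡ p i
  lower i i≢j with i ∈? S
  ... | no  i∉S = contradiction (unique i i∉S) i≢j
  ... | yes i∈S = trans (cong suc (takeOne i i∈S)) (trans (+-comm 1 (p i ∸ 1)) (m∸n+n≡m (nonempty i i∈S)))

lowerAllBut : ∀ {n} → Fin n → Position n → Position n
lowerAllBut j p i with i ≟ᶠ j
... | yes _ = p i
... | no  _ = p i ∸ 1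

lowerAllBut-skip : ∀ {n} (j : Fin n) (p : Position n) → (∀ i → i ≢ j → 1 ≤ p i) → Skip j p (lowerAllBut j p)
lowerAllBut-skip j p nonempty = record { lower = lower ; keep = keep }
  where
  lower : ∀ i → i ≢ j → suc (lowerAllBut j p i) ≡ p i
  lower i i≢j with i ≟ᶠ j
  ... | yes i≡j = contradiction i≡j i≢j
  ... | no  _   = trans (+-comm 1 (p i ∸ 1)) (m∸n+n≡m (nonempty i i≢j))
  keep : lowerAllBut j p j ≡ p j
  keep with j ≟ᶠ j
  ... | yes _   = refl
  ... | no  j≢j = contradiction refl j≢j

lowerAllBut-move : ∀ {k} (j : Fin (suc k)) (p : Position (suc k)) →
  (∀ i → i ≢ j → 1 ≤ p i) → Move (Single k) p (lowerAllBut j p)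
lowerAllBut-move {k} j p nonempty = move (∁ ⁅ j ⁆) ∣∁⁅j⁆∣≡k (λ i → nonempty i ∘ ≢j) takeOne keep′
  where
  open Skip (lowerAllBut-skip j p nonempty)
  ∣∁⁅j⁆∣≡k : ∣ ∁ ⁅ j ⁆ ∣ ≡ k
  ∣∁⁅j⁆∣≡k = trans (∣∁p∣≡n∸∣p∣ ⁅ j ⁆) (cong (suc k ∸_) (∣⁅x⁆∣≡1 j))
  ≢j : ∀ {i} → i ∈ ∁ ⁅ j ⁆ → i ≢ j
  ≢j {i} i∈ refl = x∈∁p⇒x∉p i∈ (x∈⁅x⁆ i)
  takeOne : ∀ i → i ∈ ∁ ⁅ j ⁆ → lowerAllBut j p i ≡ p i ∸ 1
  takeOne i i∈ = cong (_∸ 1) (lower i (≢j i∈))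
  keep′ : ∀ i → i ∉ ∁ ⁅ j ⁆ → lowerAllBut j p i ≡ p i
  keep′ i i∉ with x∈⁅y⁆⇒x≡y j (x∉∁p⇒x∈p i∉)
  ... | refl = keep

P⇒¬N : ∀ {n} {A : ℕ → Set} {p : Position n} → IsP A p → ¬ IsN A p
P⇒¬N (isP allN) (isN q p⟶q qP) = P⇒¬N qP (allN q p⟶q)

atLeast : ℕ → ℕ → ℕ
atLeast zero    x       = 1
atLeast (suc L) zero    = 0
atLeast (suc L) (suc x) = atLeast L x

atLeast-≤ : ∀ {L x} → L ≤ x → atLeast L x ≡ 1
atLeast-≤ {zero}          _         = refl
atLeast-≤ {suc L} {suc x} (s≤s L≤x) = atLeast-≤ L≤x

atLeast-> : ∀ {L x} → x < L → atLeast L x ≡ 0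
atLeast-> {suc L} {zero}  _         = refl
atLeast-> {suc L} {suc x} (s≤s x<L) = atLeast-> x<L

atLeast≤1 : ∀ L x → atLeast L x ≤ 1
atLeast≤1 zero    x       = s≤s z≤n
atLeast≤1 (suc L) zero    = z≤n
atLeast≤1 (suc L) (suc x) = atLeast≤1 L x

⊓-suc : ∀ x L → x ⊓ suc L ≡ x ⊓ L + atLeast (suc L) x
⊓-suc zero    L       = refl
⊓-suc (suc x) zero    = cong suc (⊓-zeroʳ x)
⊓-suc (suc x) (suc L) = cong suc (⊓-suc x L)

bit-clip : ∀ {x M} → (x ≤ M → bit x ≡ 1) → (M < x → bit (suc M) ≡ 1) → bit (x ⊓ suc M) ≡ 1
bit-clip {x} {M} short-odd tall-odd with x ≤? M
... | yes x≤M = trans (cong bit (m≤n⇒m⊓n≡m (m≤n⇒m≤1+n x≤M))) (short-odd x≤M)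
... | no  x≰M = trans (cong bit (m≥n⇒m⊓n≡n (≰⇒> x≰M))) (tall-odd (≰⇒> x≰M))

module _ {n : ℕ} where

  clip : ℕ → Position n → ℕ
  clip L p = sum (λ i → p i ⊓ L)

  tall : ℕ → Position n → ℕ
  tall L p = sum (λ i → atLeast L (p i))

  clipOdd : ℕ → Position n → ℕ
  clipOdd L p = sum (λ i → bit (p i ⊓ L))

  clip-suc : ∀ L p → clip (suc L) p ≡ clip L p + tall (suc L) p
  clip-suc L p = trans (sum-cong-≗ (λ i → ⊓-suc (p i) L)) (∑-distrib-+ (λ i → p i ⊓ L) _)

  clip-zero : ∀ p → clip 0 p ≡ 0
  clip-zero p = trans (sum-cong-≗ (λ i → ⊓-zeroʳ (p i))) (trans (sum-const n 0) (*-zeroʳ n))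

  clipOdd-zero : ∀ p → clipOdd 0 p ≡ 0
  clipOdd-zero p = trans (sum-cong-≗ (λ i → cong bit (⊓-zeroʳ (p i)))) (trans (sum-const n 0) (*-zeroʳ n))

module SkipEffect {k : ℕ} {j : Fin (suc k)} {p q : Position (suc k)} (skip : Skip j p q) where
  open Skip skip

  private
    n : ℕ
    n = suc k

    clip-lowered : ∀ L → clip L q + n + p j ⊓ suc L ≡ clip (suc L) p + suc (p j ⊓ L)
    clip-lowered L = subst (λ x → clip L q + n + p j ⊓ suc L ≡ clip (suc L) p + suc (x ⊓ L)) keep
      (sum-lowered j (λ i i≢j → cong (_⊓ suc L) (lower i i≢j)))

  sum-skip : sum q + k ≡ sum p
  sum-skip = +-cancelʳ-≡ (suc (p j)) _ _ (begin
    sum q + k + suc (p j)  ≡⟨ shuffle (sum q) k (p j) ⟩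
    sum q + n + p j        ≡⟨ sum-lowered j lower ⟩
    sum p + suc (q j)      ≡⟨ cong (λ x → sum p + suc x) keep ⟩
    sum p + suc (p j)      ∎)
    where
    open ≡-Reasoning
    shuffle : ∀ a b c → a + b + suc c ≡ a + suc b + c
    shuffle = solve-∀

  skip-≤ : ∀ i → p i ≤ suc (q i)
  skip-≤ i with i ≟ᶠ j
  ... | yes refl = ≤-trans (≤-reflexive (sym keep)) (n≤1+n (q i))
  ... | no  i≢j  = ≤-reflexive (sym (lower i i≢j))

  clip-skip-≤ : ∀ L → p j ≤ L → clip L q + n ≡ clip (suc L) p + 1
  clip-skip-≤ L pj≤L = +-cancelʳ-≡ (p j) _ _ (begin
    clip L q + n + p j              ≡⟨ cong (clip L q + n +_) (m≤n⇒m⊓n≡m (m≤n⇒m≤1+n pj≤L)) ⟨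
    clip L q + n + p j ⊓ suc L      ≡⟨ clip-lowered L ⟩
    clip (suc L) p + suc (p j ⊓ L)  ≡⟨ cong (λ x → clip (suc L) p + suc x) (m≤n⇒m⊓n≡m pj≤L) ⟩
    clip (suc L) p + suc (p j)      ≡⟨ +-suc (clip (suc L) p) (p j) ⟩
    suc (clip (suc L) p + p j)      ≡⟨ cong (_+ p j) (+-comm 1 (clip (suc L) p)) ⟩
    clip (suc L) p + 1 + p j        ∎)
    where open ≡-Reasoning

  clip-skip-> : ∀ L → L < p j → clip L q + n ≡ clip (suc L) p
  clip-skip-> L L<pj = +-cancelʳ-≡ (suc L) _ _ (begin
    clip L q + n + suc L            ≡⟨ cong (clip L q + n +_) (m≥n⇒m⊓n≡n L<pj) ⟨
    clip L q + n + p j ⊓ suc L      ≡⟨ clip-lowered L ⟩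
    clip (suc L) p + suc (p j ⊓ L)  ≡⟨ cong (λ x → clip (suc L) p + suc x) (m≥n⇒m⊓n≡n (<⇒≤ L<pj)) ⟩
    clip (suc L) p + suc L          ∎)
    where open ≡-Reasoning

  clip-skip : ∀ L → clip L q + n ≤ clip (suc L) p + 1
  clip-skip L with p j ≤? L
  ... | yes pj≤L = ≤-reflexive (clip-skip-≤ L pj≤L)
  ... | no  pj≰L = ≤-trans (≤-reflexive (clip-skip-> L (≰⇒> pj≰L))) (m≤m+n _ 1)

  private
    odd-pair : ∀ M i → i ≢ j → bit (q i ⊓ M) + bit (p i ⊓ suc M) ≡ 1
    odd-pair M i i≢j = begin
      bit (q i ⊓ M) + bit (p i ⊓ suc M)        ≡⟨ cong (λ x → bit (q i ⊓ M) + bit (x ⊓ suc M)) (lower i i≢j) ⟨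
      bit (q i ⊓ M) + bit (suc (q i ⊓ M))      ≡⟨ +-comm (bit (q i ⊓ M)) _ ⟩
      bit (suc (q i ⊓ M)) + bit (q i ⊓ M)      ≡⟨ bit-suc (q i ⊓ M) ⟩
      1                                        ∎
      where open ≡-Reasoning

    clipOdd-skip : ∀ M {a b} → bit (q j ⊓ M) + bit (p j ⊓ suc M) + a ≡ 1 + b →
      clipOdd M q + clipOdd (suc M) p + a ≡ n + b
    clipOdd-skip M {a} {b} at-j = begin
      clipOdd M q + clipOdd (suc M) p + a                  ≡⟨ cong (_+ a) (∑-distrib-+ (λ i → bit (q i ⊓ M)) (λ i → bit (p i ⊓ suc M))) ⟨
      sum (λ i → bit (q i ⊓ M) + bit (p i ⊓ suc M)) + a    ≡⟨ sum-differ-at j (odd-pair M) at-j ⟩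
      sum {n} (λ _ → 1) + b                                ≡⟨ cong (_+ b) (sum-ones {n} (λ _ → refl)) ⟩
      n + b                                                ∎
      where open ≡-Reasoning

  clipOdd-skip-≤ : ∀ M → p j ≤ M → clipOdd M q + clipOdd (suc M) p ≡ 2 * bit (p j) + k
  clipOdd-skip-≤ M pj≤M = +-cancelʳ-≡ 1 _ _ (trans (clipOdd-skip M at-j) (shuffle k (bit (p j))))
    where
    shuffle : ∀ a b → suc a + 2 * b ≡ 2 * b + a + 1
    shuffle = solve-∀
    at-j : bit (q j ⊓ M) + bit (p j ⊓ suc M) + 1 ≡ 1 + 2 * bit (p j)
    at-j rewrite keep | m≤n⇒m⊓n≡m pj≤M | m≤n⇒m⊓n≡m (m≤n⇒m≤1+n pj≤M) = lemma (bit (p j))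
      where lemma : ∀ b → b + b + 1 ≡ 1 + 2 * b
            lemma = solve-∀

  clipOdd-skip-> : ∀ M → M < p j → clipOdd M q + clipOdd (suc M) p ≡ n
  clipOdd-skip-> M M<pj = trans (sym (+-identityʳ _)) (trans (clipOdd-skip M at-j) (+-identityʳ n))
    where
    at-j : bit (q j ⊓ M) + bit (p j ⊓ suc M) + 0 ≡ 1 + 0
    at-j rewrite keep | m≥n⇒m⊓n≡n (<⇒≤ M<pj) | m≥n⇒m⊓n≡n M<pj =
      trans (+-identityʳ _) (trans (+-comm (bit M) _) (bit-suc M))

  private
    lower-≥ : ∀ {L} i → suc L ≤ p i → L ≤ q i
    lower-≥ i sL≤pi with i ≟ᶠ j
    ... | yes refl = ≤-trans (n≤1+n _) (subst (_ ≤_) (sym keep) sL≤pi)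
    ... | no  i≢j  = ≤-pred (subst (_ ≤_) (sym (lower i i≢j)) sL≤pi)

  clipOdd-skip-tall : ∀ M → let L = suc (suc M) in L ≤ p j →
    clipOdd M q + clipOdd L p + tall L p ≡ 2 * bit M * tall L p + n
  clipOdd-skip-tall M L≤pj = begin
    clipOdd M q + clipOdd L p + tall L p
      ≡⟨ cong (_+ tall L p) (∑-distrib-+ oddq oddp) ⟨
    sum (λ i → oddq i + oddp i) + tall L p
      ≡⟨ ∑-distrib-+ (λ i → oddq i + oddp i) (λ i → atLeast L (p i)) ⟨
    sum (λ i → oddq i + oddp i + atLeast L (p i))
      ≡⟨ sum-cong-≗ pointwise ⟩
    sum (λ i → 1 + 2 * bit M * atLeast L (p i))
      ≡⟨ ∑-distrib-+ (λ _ → 1) (λ i → 2 * bit M * atLeast L (p i)) ⟩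
    sum {n} (λ _ → 1) + sum (λ i → 2 * bit M * atLeast L (p i))
      ≡⟨ cong₂ _+_ (sum-ones {n} (λ _ → refl)) (sym (*-distribˡ-sum (2 * bit M) (λ i → atLeast L (p i)))) ⟩
    n + 2 * bit M * tall L p
      ≡⟨ +-comm n _ ⟩
    2 * bit M * tall L p + n
      ∎
    where
    open ≡-Reasoning
    L : ℕ
    L = suc (suc M)
    oddq oddp : Fin n → ℕ
    oddq i = bit (q i ⊓ M)
    oddp i = bit (p i ⊓ L)
    pointwise-short : ∀ i → p i < L → oddq i + oddp i + atLeast L (p i) ≡ 1 + 2 * bit M * atLeast L (p i)
    pointwise-short i pi<L with i ≟ᶠ j
    ... | yes refl = contradiction L≤pj (<⇒≱ pi<L)
    ... | no  i≢j rewrite atLeast-> pi<L | m≤n⇒m⊓n≡m (<⇒≤ pi<L)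
                        | m≤n⇒m⊓n≡m (≤-pred (≤-pred (subst (_< L) (sym (lower i i≢j)) pi<L)))
                        | *-zeroʳ (2 * bit M) | sym (lower i i≢j) =
      trans (+-identityʳ _) (trans (+-comm (bit (q i)) _) (bit-suc (q i)))
    pointwise : ∀ i → oddq i + oddp i + atLeast L (p i) ≡ 1 + 2 * bit M * atLeast L (p i)
    pointwise i with L ≤? p i
    ... | yes L≤pi rewrite atLeast-≤ L≤pi | m≥n⇒m⊓n≡n L≤pi | m≥n⇒m⊓n≡n (<⇒≤ (lower-≥ i L≤pi)) = lemma (bit M)
      where lemma : ∀ b → b + b + 1 ≡ 1 + 2 * b * 1
            lemma = solve-∀
    ... | no  L≰pi = pointwise-short i (≰⇒> L≰pi)

module Classification (m : ℕ) where

  k n : ℕ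
  k = suc m
  n = suc k

  record Level (p : Position n) (L F : ℕ) : Set where
    constructor level
    field
      clip≡     : clip L p ≡ k * L + F
      clip-suc< : clip (suc L) p < k * suc L

  module _ {p : Position n} {L F : ℕ} (lv : Level p L F) where
    open Level lv

    excess<k : F < k
    excess<k = +-cancelʳ-< (k * L) F k (begin-strict
      F + k * L        ≡⟨ +-comm F (k * L) ⟩
      k * L + F        ≡⟨ clip≡ ⟨
      clip L p         ≤⟨ sum-mono-≤ (λ i → ⊓-monoʳ-≤ (p i) (n≤1+n L)) ⟩
      clip (suc L) p   <⟨ clip-suc< ⟩
      k * suc L        ≡⟨ *-suc k L ⟩
      k + k * L        ∎)
      where open ≤-Reasoning

    parity-clipOdd : parity (clipOdd L p) ≡ parity L ℙ.* parity k ℙ.+ parity F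
    parity-clipOdd = begin
      parity (clipOdd L p)             ≡⟨ parity-sum-bit (λ i → p i ⊓ L) ⟩
      parity (clip L p)                ≡⟨ cong parity clip≡ ⟩
      parity (k * L + F)               ≡⟨ ℙ.+-homo-+ (k * L) F ⟩
      parity (k * L) ℙ.+ parity F      ≡⟨ cong (ℙ._+ parity F) (trans (ℙ.*-homo-* k L) (ℙ.*-comm (parity k) _)) ⟩
      parity L ℙ.* parity k ℙ.+ parity F ∎
      where open ≡-Reasoning

  level-zero : ∀ {p F} → Level p 0 F → F ≡ 0
  level-zero {p} {F} lv = sym (trans (sym (clip-zero p)) (trans (Level.clip≡ lv) (cong (_+ F) (*-zeroʳ k))))

  parity-clipOdd-suc : ∀ {p M F λ′} → Level p (suc M) F → parity M ≡ λ′ →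
    parity (clipOdd (suc M) p) ≡ λ′ ℙ.⁻¹ ℙ.* parity k ℙ.+ parity F
  parity-clipOdd-suc {M = M} {F} lv M≡λ′ =
    trans (parity-clipOdd lv) (cong (λ λ″ → λ″ ℙ.* parity k ℙ.+ parity F) (parity-suc-≡ M M≡λ′))

  excess-all-tall : ∀ {p M F} → Level p (suc M) F → (∀ i → M < p i) → F ≡ suc M
  excess-all-tall {p} {M} {F} lv all-tall = +-cancelˡ-≡ (k * suc M) F (suc M) (begin
    k * suc M + F          ≡⟨ Level.clip≡ lv ⟨
    clip (suc M) p         ≡⟨ sum-cong-≗ (λ i → m≥n⇒m⊓n≡n (all-tall i)) ⟩
    sum {n} (λ _ → suc M)  ≡⟨ sum-const n (suc M) ⟩
    n * suc M              ≡⟨ +-comm (suc M) (k * suc M) ⟩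
    k * suc M + suc M      ∎)
    where open ≡-Reasoning

  at-most-one-zero : ∀ {p M F} → Level p (suc M) F → ∀ z → p z ≡ 0 → ∀ i → i ≢ z → 1 ≤ p i
  at-most-one-zero {p} {M} {F} lv z pz≡0 i i≢z with p i in pi≡0
  ... | suc _ = s≤s z≤n
  ... | zero  = contradiction k≤tall (<⇒≱ tall<k)
    where
    tall<k : tall 1 p < k
    tall<k = s≤s (sum≤n-zeroAt₂ (λ i → atLeast≤1 1 (p i)) z i (λ z≡i → i≢z (sym z≡i))
                   (cong (atLeast 1) pz≡0) (cong (atLeast 1) pi≡0))
    clip≤ : ∀ i → p i ⊓ suc M ≤ suc M * atLeast 1 (p i)
    clip≤ i with p i
    ... | zero  = z≤n
    ... | suc x = subst (suc x ⊓ suc M ≤_) (sym (*-identityʳ (suc M))) (m⊓n≤n (suc x) (suc M))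
    k≤tall : k ≤ tall 1 p
    k≤tall = *-cancelˡ-≤ (suc M) (begin
      suc M * k                        ≡⟨ *-comm (suc M) k ⟩
      k * suc M                        ≤⟨ m≤m+n _ F ⟩
      k * suc M + F                    ≡⟨ Level.clip≡ lv ⟨
      clip (suc M) p                   ≤⟨ sum-mono-≤ clip≤ ⟩
      sum (λ i → suc M * atLeast 1 (p i)) ≡⟨ *-distribˡ-sum (suc M) (λ i → atLeast 1 (p i)) ⟨
      suc M * tall 1 p                 ∎)
      where open ≤-Reasoning

  module Descend {j : Fin n} {p q : Position n} (skip : Skip j p q) where
    open Skip skip
    open SkipEffect skip

    sum-decreases : sum q < sum p
    sum-decreases = begin-strict
      sum q      <⟨ m<m+n (sum q) (s≤s z≤n) ⟩
      sum q + k  ≡⟨ sum-skip ⟩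
      sum p      ∎
      where open ≤-Reasoning

    ¬level-zero : ∀ {F} → ¬ Level p 0 F
    ¬level-zero {F} lv = 1+n≰n (begin
      n                  ≡⟨ cong (_+ n) (clip-zero q) ⟨
      clip 0 q + n       ≤⟨ clip-skip 0 ⟩
      clip 1 p + 1       ≡⟨ +-comm (clip 1 p) 1 ⟩
      suc (clip 1 p)     ≤⟨ Level.clip-suc< lv ⟩
      k * 1              ≡⟨ *-identityʳ k ⟩
      k                  ∎)
      where open ≤-Reasoning

    private
      clip-suc<-skip : ∀ M → clip (suc (suc M)) p < k * suc (suc M) → clip (suc M) q < k * suc M
      clip-suc<-skip M clip< = +-cancelʳ-≤ n _ _ (begin
        suc (clip (suc M) q) + n         ≤⟨ s≤s (clip-skip (suc M)) ⟩
        suc (clip (suc (suc M)) p + 1)   ≤⟨ +-monoˡ-≤ 1 clip< ⟩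
        k * suc (suc M) + 1              ≡⟨ shuffle k M ⟩
        k * suc M + n                    ∎)
        where
        open ≤-Reasoning
        shuffle : ∀ a b → a * suc (suc b) + 1 ≡ a * suc b + suc a
        shuffle = solve-∀

    level-skip-≤ : ∀ {M F} → p j ≤ M → Level p (suc M) F → Level q M F
    level-skip-≤ {M} {F} pj≤M (level clip≡ clip<) = level (+-cancelʳ-≡ n _ _ (begin
      clip M q + n            ≡⟨ clip-skip-≤ M pj≤M ⟩
      clip (suc M) p + 1      ≡⟨ cong (_+ 1) clip≡ ⟩
      k * suc M + F + 1       ≡⟨ shuffle k M F ⟩
      k * M + F + n           ∎)) (clip-suc<-skip M clip<)
      where
      open ≡-Reasoning
      shuffle : ∀ a b c → a * suc b + c + 1 ≡ a * b + c + suc a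
      shuffle = solve-∀

    level-skip-> : ∀ {M F} → M < p j → Level p (suc M) (suc F) → Level q M F
    level-skip-> {M} {F} M<pj (level clip≡ clip<) = level (+-cancelʳ-≡ n _ _ (begin
      clip M q + n            ≡⟨ clip-skip-> M M<pj ⟩
      clip (suc M) p          ≡⟨ clip≡ ⟩
      k * suc M + suc F       ≡⟨ shuffle k M F ⟩
      k * M + F + n           ∎)) (clip-suc<-skip M clip<)
      where
      open ≡-Reasoning
      shuffle : ∀ a b c → a * suc b + suc c ≡ a * b + c + suc a
      shuffle = solve-∀

    clipOdd-pos : ∀ {M} → M < p j → parity M ≡ 1ℙ → 1 ≤ clipOdd M q
    clipOdd-pos {M} M<pj M-odd = ≤-trans (≤-reflexive (sym bit-at-j)) (term≤sum (λ i → bit (q i ⊓ M)) j)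
      where
      bit-at-j : bit (q j ⊓ M) ≡ 1
      bit-at-j = trans (cong (λ x → bit (x ⊓ M)) keep) (trans (cong bit (m≥n⇒m⊓n≡n (<⇒≤ M<pj))) (cong toℕ M-odd))

    -- For M = 0 the conclusion is absurd: at level 1 with excess 0 no stack of height ≥ 1 can be skipped.
    tall-bound : ∀ M → suc M ≤ p j → Level p (suc M) 0 → M * tall (suc M) p < M * k
    tall-bound M sM≤pj (level clip≡ _) = +-cancelˡ-≤ k _ _ (begin
      k + suc (M * T)                           ≡⟨ +-suc k (M * T) ⟩
      n + M * T                                 ≡⟨ cong₂ _+_ (sum-ones {n} (λ _ → refl)) (sym (*-distribˡ-sum M (λ i → atLeast (suc M) (p i)))) ⟨
      sum {n} (λ _ → 1) + sum (λ i → M * atLeast (suc M) (p i)) ≡⟨ ∑-distrib-+ (λ _ → 1) (λ i → M * atLeast (suc M) (p i)) ⟨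
      sum (λ i → 1 + M * atLeast (suc M) (p i)) ≤⟨ sum-mono-≤ pointwise ⟩
      clip (suc M) p                            ≡⟨ clip≡ ⟩
      k * suc M + 0                             ≡⟨ trans (+-identityʳ _) (trans (*-suc k M) (cong (k +_) (*-comm k M))) ⟩
      k + M * k                                 ∎)
      where
      open ≤-Reasoning
      T : ℕ
      T = tall (suc M) p
      pointwise : ∀ i → 1 + M * atLeast (suc M) (p i) ≤ p i ⊓ suc M
      pointwise i with suc M ≤? p i | i ≟ᶠ j
      ... | yes sM≤pi | _ rewrite atLeast-≤ sM≤pi | m≥n⇒m⊓n≡n sM≤pi | *-identityʳ M = ≤-refl
      ... | no  sM≰pi | yes refl = contradiction sM≤pj sM≰pi
      ... | no  sM≰pi | no  i≢j rewrite atLeast-> (≰⇒> sM≰pi) | *-zeroʳ M =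
        ⊓-glb (subst (1 ≤_) (lower i i≢j) (s≤s z≤n)) (s≤s z≤n)

    level-skip-tall : ∀ M → let L = suc (suc M) in L ≤ p j → Level p L 0 →
      ∃ λ F → F + tall L p + 1 ≡ k × 1 ≤ tall L p × Level q M F
    level-skip-tall M L≤pj lv@(level clip≡ _) = F , F+T+1≡k , 1≤T , level clip≡F clip<
      where
      L : ℕ
      L = suc (suc M)
      T : ℕ
      T = tall L p
      T<k : T < k
      T<k = *-cancelˡ-< (suc M) T k (tall-bound (suc M) L≤pj lv)
      F : ℕ
      F = k ∸ suc T
      F+T+1≡k : F + T + 1 ≡ k
      F+T+1≡k = trans (+-assoc F T 1) (trans (cong (F +_) (+-comm T 1)) (m∸n+n≡m T<k))
      1≤T : 1 ≤ T
      1≤T = ≤-trans (≤-reflexive (sym (atLeast-≤ L≤pj))) (term≤sum (λ i → atLeast L (p i)) j)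
      clip≡F : clip M q ≡ k * M + F
      clip≡F = +-cancelʳ-≡ (n + T) _ _ (begin
        clip M q + (n + T)        ≡⟨ +-assoc (clip M q) n T ⟨
        clip M q + n + T          ≡⟨ cong (_+ T) (clip-skip-> M (≤-trans (s≤s (n≤1+n M)) L≤pj)) ⟩
        clip (suc M) p + T        ≡⟨ clip-suc (suc M) p ⟨
        clip L p                  ≡⟨ clip≡ ⟩
        k * L + 0                 ≡⟨ shuffle₁ k M ⟩
        k * M + k + k             ≡⟨ cong (λ x → k * M + x + k) F+T+1≡k ⟨
        k * M + (F + T + 1) + k   ≡⟨ shuffle₂ (k * M) F T k ⟩
        k * M + F + (n + T)       ∎)
        where
        open ≡-Reasoning
        shuffle₁ : ∀ a b → a * suc (suc b) + 0 ≡ a * b + a + a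
        shuffle₁ = solve-∀
        shuffle₂ : ∀ a b c d → a + (b + c + 1) + d ≡ a + b + (suc d + c)
        shuffle₂ = solve-∀
      clip< : clip (suc M) q < k * suc M
      clip< = +-cancelʳ-≤ n _ _ (begin
        suc (clip (suc M) q) + n  ≡⟨ cong suc (clip-skip-> (suc M) L≤pj) ⟩
        suc (clip L p)            ≡⟨ cong suc clip≡ ⟩
        suc (k * L + 0)           ≡⟨ shuffle k M ⟩
        k * suc M + n             ∎)
        where
        open ≤-Reasoning
        shuffle : ∀ a b → suc (a * suc (suc b) + 0) ≡ a * suc b + suc a
        shuffle = solve-∀

  -- With s = F + k·(L mod 2), the two even-level clauses are S₁ and S₂, and the odd-level clause is S₃.
  Losing : Parity → ℕ → ℕ → Set
  Losing 0ℙ F o = (F + 2 ≤ k × o ≤ F) ⊎ (F + 1 ≡ k × parity o ≡ parity n)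
  Losing 1ℙ F o = F + 2 ≤ k × o + F + 2 ≤ k

  losing? : ∀ λ′ F o → Dec (Losing λ′ F o)
  losing? 0ℙ F o = ((F + 2 ≤? k) ×-dec (o ≤? F)) ⊎-dec ((F + 1 ≟ k) ×-dec (parity o ℙ.≟ parity n))
  losing? 1ℙ F o = (F + 2 ≤? k) ×-dec (o + F + 2 ≤? k)

  losing-at : ∀ M {λ′ F o} → parity M ≡ λ′ → Losing λ′ F o → Losing (parity M) F o
  losing-at M M≡λ′ = subst (λ λ″ → Losing λ″ _ _) (sym M≡λ′)

  losing-origin : Losing 0ℙ 0 0
  losing-origin with m ≟ 0
  ... | yes m≡0 = inj₂ (cong suc (sym m≡0) , cong parity (sym m≡0))
  ... | no  m≢0 = inj₁ (s≤s (n≢0⇒n>0 m≢0) , z≤n)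

  F+1≡k⇒F+2≰k : ∀ {F} → F + 1 ≡ k → ¬ F + 2 ≤ k
  F+1≡k⇒F+2≰k {F} F+1≡k F+2≤k =
    m+1+n≰m (F + 1) (≤-trans (≤-reflexive (+-assoc F 1 1)) (≤-trans F+2≤k (≤-reflexive (sym F+1≡k))))

  ¬losing-skip-≤ : ∀ λ′ {F o o′ c} → Losing (λ′ ℙ.⁻¹) F o → o′ + o ≡ c + k → ¬ Losing λ′ F o′
  ¬losing-skip-≤ 0ℙ {F} {o} {o′} {c} (_ , o+F+2≤k) o′+o≡ (inj₁ (_ , o′≤F)) = m+1+n≰m (o′ + o) (begin
    o′ + o + 2      ≤⟨ +-monoˡ-≤ 2 (+-monoˡ-≤ o o′≤F) ⟩
    F + o + 2       ≡⟨ cong (_+ 2) (+-comm F o) ⟩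
    o + F + 2       ≤⟨ o+F+2≤k ⟩
    k               ≤⟨ m≤n+m k c ⟩
    c + k           ≡⟨ o′+o≡ ⟨
    o′ + o          ∎)
    where open ≤-Reasoning
  ¬losing-skip-≤ 0ℙ (F+2≤k , _) _ (inj₂ (F+1≡k , _)) = F+1≡k⇒F+2≰k F+1≡k F+2≤k
  ¬losing-skip-≤ 1ℙ {F} {o} {o′} {c} (inj₁ (_ , o≤F)) o′+o≡ (_ , o′+F+2≤k) = m+1+n≰m (o′ + o) (begin
    o′ + o + 2      ≤⟨ +-monoˡ-≤ 2 (+-monoʳ-≤ o′ o≤F) ⟩
    o′ + F + 2      ≤⟨ o′+F+2≤k ⟩
    k               ≤⟨ m≤n+m k c ⟩
    c + k           ≡⟨ o′+o≡ ⟨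
    o′ + o          ∎)
    where open ≤-Reasoning
  ¬losing-skip-≤ 1ℙ (inj₂ (F+1≡k , _)) _ (F+2≤k , _) = F+1≡k⇒F+2≰k F+1≡k F+2≤k

  ¬losing-skip-> : ∀ λ′ {F o o′} → Losing (λ′ ℙ.⁻¹) (suc F) o → o′ + o ≡ n → (λ′ ≡ 1ℙ → 1 ≤ o′) → ¬ Losing λ′ F o′
  ¬losing-skip-> 0ℙ {F} {o} {o′} (_ , o+F+3≤k) o′+o≡n _ (inj₁ (_ , o′≤F)) = m+1+n≰m (o′ + o) (begin
    o′ + o + 2         ≤⟨ +-monoˡ-≤ 2 (+-monoˡ-≤ o o′≤F) ⟩
    F + o + 2          ≡⟨ shuffle F o ⟩
    o + suc F + 1      ≤⟨ +-monoʳ-≤ (o + suc F) (s≤s z≤n) ⟩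
    o + suc F + 2      ≤⟨ o+F+3≤k ⟩
    k                  ≤⟨ n≤1+n k ⟩
    n                  ≡⟨ o′+o≡n ⟨
    o′ + o             ∎)
    where
    open ≤-Reasoning
    shuffle : ∀ a b → a + b + 2 ≡ b + suc a + 1
    shuffle = solve-∀
  ¬losing-skip-> 0ℙ {F} (F+3≤k , _) _ _ (inj₂ (F+1≡k , _)) = m+1+n≰m (F + 1) (begin
    F + 1 + 2          ≡⟨ shuffle F ⟩
    suc F + 2          ≤⟨ F+3≤k ⟩
    k                  ≡⟨ F+1≡k ⟨
    F + 1              ∎)
    where
    open ≤-Reasoning
    shuffle : ∀ a → a + 1 + 2 ≡ suc a + 2
    shuffle = solve-∀
  ¬losing-skip-> 1ℙ {F} {o} {o′} (inj₁ (_ , o≤F+1)) o′+o≡n _ (_ , o′+F+2≤k) = m+1+n≰m (o′ + o) (begin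
    o′ + o + 1         ≤⟨ +-monoˡ-≤ 1 (+-monoʳ-≤ o′ o≤F+1) ⟩
    o′ + suc F + 1     ≡⟨ shuffle o′ F ⟩
    o′ + F + 2         ≤⟨ o′+F+2≤k ⟩
    k                  ≤⟨ n≤1+n k ⟩
    n                  ≡⟨ o′+o≡n ⟨
    o′ + o             ∎)
    where
    open ≤-Reasoning
    shuffle : ∀ a b → a + suc b + 1 ≡ a + b + 2
    shuffle = solve-∀
  ¬losing-skip-> 1ℙ {F} {o} {o′} (inj₂ (F+2≡k , _)) _ 1≤o′ (_ , o′+F+2≤k) = m+1+n≰m (F + 2) (begin
    F + 2 + 1          ≡⟨ +-comm (F + 2) 1 ⟩
    1 + (F + 2)        ≤⟨ +-monoˡ-≤ (F + 2) (1≤o′ refl) ⟩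
    o′ + (F + 2)       ≡⟨ +-assoc o′ F 2 ⟨
    o′ + F + 2         ≤⟨ o′+F+2≤k ⟩
    k                  ≡⟨ F+2≡k ⟨
    suc F + 1          ≡⟨ shuffle F ⟩
    F + 2              ∎)
    where
    open ≤-Reasoning
    shuffle : ∀ a → suc a + 1 ≡ a + 2
    shuffle = solve-∀

  ¬losing-skip-tall : ∀ λ′ {o o′ T F} → Losing λ′ 0 o → 1 ≤ T → F + T + 1 ≡ k →
    o′ + o + T ≡ 2 * toℕ λ′ * T + n → ¬ Losing λ′ F o′
  ¬losing-skip-tall 0ℙ {o} {o′} {T} {F} (inj₁ (_ , o≤0)) _ F+T+1≡k o′+o+T≡n (inj₁ (_ , o′≤F)) =
    m+1+n≰m F (≤-trans (≤-reflexive (sym o′≡F+2)) o′≤F)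
    where
    o′≡F+2 : o′ ≡ F + 2
    o′≡F+2 = +-cancelʳ-≡ T _ _ (begin
      o′ + T            ≡⟨ cong (_+ T) (+-identityʳ o′) ⟨
      o′ + 0 + T        ≡⟨ cong (λ x → o′ + x + T) (n≤0⇒n≡0 o≤0) ⟨
      o′ + o + T        ≡⟨ o′+o+T≡n ⟩
      suc k             ≡⟨ cong suc F+T+1≡k ⟨
      suc (F + T + 1)   ≡⟨ shuffle F T ⟩
      F + 2 + T         ∎)
      where
      open ≡-Reasoning
      shuffle : ∀ a b → suc (a + b + 1) ≡ a + 2 + b
      shuffle = solve-∀
  ¬losing-skip-tall 0ℙ {T = suc T} {F} (inj₁ _) _ F+T+1≡k _ (inj₂ (F+1≡k , _)) =
    m+1+n≢m (F + 1) (trans (shuffle F T) (trans F+T+1≡k (sym F+1≡k)))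
    where
    shuffle : ∀ a b → a + 1 + suc b ≡ a + suc b + 1
    shuffle = solve-∀
  ¬losing-skip-tall 0ℙ {T = suc T} {F} (inj₂ (1≡k , _)) _ F+T+1≡k _ _ =
    m+1+n≢m 1 (trans (shuffle F T) (trans F+T+1≡k (sym 1≡k)))
    where
    shuffle : ∀ a b → 1 + suc (a + b) ≡ a + suc b + 1
    shuffle = solve-∀
  ¬losing-skip-tall 1ℙ {o} {o′} {T} {F} (_ , o+2≤k) _ F+T+1≡k o′+o+T≡ (_ , o′+F+2≤k) = m+1+n≰m (k + k) (begin
    k + k + 4                  ≡⟨ cong (λ x → k + x + 4) F+T+1≡k ⟨
    k + (F + T + 1) + 4        ≡⟨ shuffle₁ k F T ⟩
    (n + T) + F + 4            ≡⟨ cong (λ x → x + F + 4) o′+o≡n+T ⟨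
    o′ + o + F + 4             ≡⟨ shuffle₂ o′ o F ⟩
    (o′ + F + 2) + (o + 0 + 2) ≤⟨ +-mono-≤ o′+F+2≤k o+2≤k ⟩
    k + k                      ∎)
    where
    open ≤-Reasoning
    shuffle₁ : ∀ a b c → a + (b + c + 1) + 4 ≡ (suc a + c) + b + 4
    shuffle₁ = solve-∀
    shuffle₂ : ∀ a b c → a + b + c + 4 ≡ (a + c + 2) + (b + 0 + 2)
    shuffle₂ = solve-∀
    shuffle₃ : ∀ a b → 2 * 1 * b + suc a ≡ suc a + b + b
    shuffle₃ = solve-∀
    o′+o≡n+T : o′ + o ≡ n + T
    o′+o≡n+T = +-cancelʳ-≡ T _ _ (trans o′+o+T≡ (shuffle₃ k T))

  ¬losing-even : ∀ {F o} → F < k → parity o ≡ parity F → ¬ Losing 0ℙ F o → F + 2 ≤ k × F + 2 ≤ o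
  ¬losing-even {F} {o} F<k o≡F ¬losing with m≤n⇒m<n∨m≡n F<k
  ... | inj₂ 1+F≡k = contradiction (inj₂ (trans (+-comm F 1) 1+F≡k , trans o≡F (cong (parity ∘ suc) 1+F≡k))) ¬losing
  ... | inj₁ F+2≤k with o ≤? F
  ...   | yes o≤F = contradiction (inj₁ (F+2≤k′ , o≤F)) ¬losing
    where F+2≤k′ = subst (_≤ k) (+-comm 2 F) F+2≤k
  ...   | no  o≰F = subst (_≤ k) (+-comm 2 F) F+2≤k , subst (_≤ o) (+-comm 2 F) (parity-gap o≡F (≰⇒> o≰F))

  ¬losing-odd : ∀ {F o} → F < k → parity o ≡ parity k ℙ.+ parity F → ¬ Losing 1ℙ F o →
    F + 1 ≡ k ⊎ (F + 2 ≤ k × k ≤ o + F)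
  ¬losing-odd {F} {o} F<k o≡k+F ¬losing with m≤n⇒m<n∨m≡n F<k
  ... | inj₂ 1+F≡k = inj₁ (trans (+-comm F 1) 1+F≡k)
  ... | inj₁ F+2≤k with o + F + 2 ≤? k
  ...   | yes o+F+2≤k = contradiction (F+2≤k′ , o+F+2≤k) ¬losing
    where F+2≤k′ = subst (_≤ k) (+-comm 2 F) F+2≤k
  ...   | no  o+F+2≰k = inj₂ (subst (_≤ k) (+-comm 2 F) F+2≤k , k≤o+F)
    where
    k≤o+F+1 : k ≤ suc (o + F)
    k≤o+F+1 = ≤-pred (subst (k <_) (+-comm (o + F) 2) (≰⇒> o+F+2≰k))
    k≢o+F+1 : k ≢ suc (o + F)
    k≢o+F+1 k≡ = not-self (parity o) (parity F) (begin
      parity o                                        ≡⟨ o≡k+F ⟩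
      parity k ℙ.+ parity F                           ≡⟨ cong (λ x → parity x ℙ.+ parity F) k≡ ⟩
      parity (suc (o + F)) ℙ.+ parity F               ≡⟨ cong (ℙ._+ parity F) (parity-suc (o + F)) ⟩
      parity (o + F) ℙ.⁻¹ ℙ.+ parity F                ≡⟨ cong (λ x → x ℙ.⁻¹ ℙ.+ parity F) (ℙ.+-homo-+ o F) ⟩
      (parity o ℙ.+ parity F) ℙ.⁻¹ ℙ.+ parity F       ∎)
      where
      open ≡-Reasoning
      not-self : ∀ a b → a ≢ (a ℙ.+ b) ℙ.⁻¹ ℙ.+ b
      not-self 0ℙ 0ℙ ()
      not-self 0ℙ 1ℙ ()
      not-self 1ℙ 0ℙ ()
      not-self 1ℙ 1ℙ ()
    k≤o+F : k ≤ o + F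
    k≤o+F = ≤-pred (≤∧≢⇒< k≤o+F+1 k≢o+F+1)

  parity-n≡F⇒F+2≢k : ∀ {F} → parity n ≡ parity F → F + 2 ≢ k
  parity-n≡F⇒F+2≢k {F} n≡F F+2≡k = ℙ.p≢p⁻¹ (parity F) (begin
    parity F          ≡⟨ n≡F ⟨
    parity (suc k)    ≡⟨ cong (parity ∘ suc) (trans (sym F+2≡k) (+-comm F 2)) ⟩
    parity (suc F)    ≡⟨ parity-suc F ⟩
    parity F ℙ.⁻¹     ∎)
    where open ≡-Reasoning

  parity-n≢k : parity n ≢ parity k
  parity-n≢k n≡k = ℙ.p≢p⁻¹ (parity k) (trans (sym n≡k) (parity-suc k))

  losing₁-≤ : ∀ {F o o′ c} → F + 2 ≤ k → c + (F + 2) ≤ o → o′ + o ≡ c + k → Losing 1ℙ F o′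
  losing₁-≤ {F} {o} {o′} {c} F+2≤k c+F+2≤o o′+o≡ = F+2≤k , +-cancelˡ-≤ c _ _ (begin
    c + (o′ + F + 2)     ≡⟨ shuffle c o′ F ⟩
    o′ + (c + (F + 2))   ≤⟨ +-monoʳ-≤ o′ c+F+2≤o ⟩
    o′ + o               ≡⟨ o′+o≡ ⟩
    c + k                ∎)
    where
    open ≤-Reasoning
    shuffle : ∀ a b c → a + (b + c + 2) ≡ b + (a + (c + 2))
    shuffle = solve-∀

  losing₁-> : ∀ {F o o′} → suc F + 2 ≤ k → suc F + 2 ≤ o → o′ + o ≡ n → Losing 1ℙ F o′
  losing₁-> {F} {o} {o′} F+3≤k F+3≤o o′+o≡n = ≤-trans (n≤1+n _) F+3≤k , ≤-pred (begin
    suc (o′ + F + 2)   ≡⟨ shuffle o′ F ⟩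
    o′ + (suc F + 2)   ≤⟨ +-monoʳ-≤ o′ F+3≤o ⟩
    o′ + o             ≡⟨ o′+o≡n ⟩
    n                  ∎)
    where
    open ≤-Reasoning
    shuffle : ∀ a b → suc (a + b + 2) ≡ a + (suc b + 2)
    shuffle = solve-∀

  losing₀-tall : ∀ {F o o′ T} → 2 ≤ o → 1 ≤ T → F + T + 1 ≡ k → o′ + o + T ≡ n → Losing 0ℙ F o′
  losing₀-tall {F} {o} {o′} {T} 2≤o 1≤T F+T+1≡k o′+o+T≡n = inj₁ (F+2≤k , o′≤F)
    where
    F+2≤k : F + 2 ≤ k
    F+2≤k = begin
      F + 2       ≡⟨ +-assoc F 1 1 ⟨
      F + 1 + 1   ≤⟨ +-monoʳ-≤ (F + 1) 1≤T ⟩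
      F + 1 + T   ≡⟨ shuffle F T ⟩
      F + T + 1   ≡⟨ F+T+1≡k ⟩
      k           ∎
      where
      open ≤-Reasoning
      shuffle : ∀ a b → a + 1 + b ≡ a + b + 1
      shuffle = solve-∀
    o′≤F : o′ ≤ F
    o′≤F = +-cancelʳ-≤ (2 + T) o′ F (begin
      o′ + (2 + T)        ≤⟨ +-monoʳ-≤ o′ (+-monoˡ-≤ T 2≤o) ⟩
      o′ + (o + T)        ≡⟨ +-assoc o′ o T ⟨
      o′ + o + T          ≡⟨ o′+o+T≡n ⟩
      suc k               ≡⟨ cong suc F+T+1≡k ⟨
      suc (F + T + 1)     ≡⟨ shuffle F T ⟩
      F + (2 + T)         ∎)
      where
      open ≤-Reasoning
      shuffle : ∀ a b → suc (a + b + 1) ≡ a + (2 + b)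
      shuffle = solve-∀

  losing₀-≤ : ∀ {F o o′ c} → F + 2 ≤ k → c + k ≤ o + F → o′ + o ≡ c + k → Losing 0ℙ F o′
  losing₀-≤ {F} {o} {o′} {c} F+2≤k c+k≤o+F o′+o≡ = inj₁ (F+2≤k , +-cancelʳ-≤ o o′ F (begin
    o′ + o    ≡⟨ o′+o≡ ⟩
    c + k     ≤⟨ c+k≤o+F ⟩
    o + F     ≡⟨ +-comm o F ⟩
    F + o     ∎))
    where open ≤-Reasoning

  losing₀-last : ∀ {F o o′ c} → F + 1 ≡ k → parity o ≡ parity k ℙ.+ parity F → o′ + o ≡ 2 * c + k → Losing 0ℙ F o′
  losing₀-last {F} {o} {o′} {c} F+1≡k o≡k+F o′+o≡ = inj₂ (F+1≡k , (begin
    parity o′                                 ≡⟨ ℙ-+-transpose (trans (sym (ℙ.+-homo-+ o′ o)) (cong parity o′+o≡)) ⟩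
    parity (2 * c + k) ℙ.+ parity o           ≡⟨ cong₂ ℙ._+_ (parity-2*+ c k) o≡k+F ⟩
    parity k ℙ.+ (parity k ℙ.+ parity F)      ≡⟨ ℙ.+-assoc (parity k) (parity k) (parity F) ⟨
    (parity k ℙ.+ parity k) ℙ.+ parity F      ≡⟨ cong (ℙ._+ parity F) (ℙ.p+p≡0ℙ (parity k)) ⟩
    parity F                                  ≡⟨ cong (parity ∘ suc) (trans (+-comm 1 F) F+1≡k) ⟩
    parity n                                  ∎))
    where open ≡-Reasoning

  losing₀-> : ∀ {F o o′} → F + 2 ≤ k → o ≡ n → o′ + o ≡ n → Losing 0ℙ F o′
  losing₀-> {F} {o} {o′} F+2≤k o≡n o′+o≡n = inj₁ (F+2≤k , subst (_≤ F) (sym o′≡0) z≤n)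
    where
    o′≡0 : o′ ≡ 0
    o′≡0 = +-cancelʳ-≡ n o′ 0 (trans (cong (o′ +_) (sym o≡n)) o′+o≡n)

  Classified : Position n → Set
  Classified p = ∀ {L F} → Level p L F →
      (Losing (parity L) F (clipOdd L p) → IsP (Single k) p)
    × (¬ Losing (parity L) F (clipOdd L p) → IsN (Single k) p)

  module Step (p : Position n) (ih : ∀ {q} → sum q < sum p → Classified q) where

    private
      module Skipping j (nonempty : ∀ i → i ≢ j → 1 ≤ p i) where
        q : Position n
        q = lowerAllBut j p
        skip : Skip j p q
        skip = lowerAllBut-skip j p nonempty
        p⟶q : Move (Single k) p q
        p⟶q = lowerAllBut-move j p nonempty
        open SkipEffect skip public
        open Descend skip public

    win-skip-≤ : ∀ {M F λ′} j → (∀ i → i ≢ j → 1 ≤ p i) → p j ≤ M → Level p (suc M) F → parity M ≡ λ′ →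
      (∀ {o′} → o′ + clipOdd (suc M) p ≡ 2 * bit (p j) + k → Losing λ′ F o′) → IsN (Single k) p
    win-skip-≤ {M} j nonempty pj≤M lv M≡λ′ losing = isN q p⟶q
      (proj₁ (ih sum-decreases (level-skip-≤ pj≤M lv)) (losing-at M M≡λ′ (losing (clipOdd-skip-≤ M pj≤M))))
      where open Skipping j nonempty

    win-skip-> : ∀ {M F λ′} j → (∀ i → i ≢ j → 1 ≤ p i) → M < p j → Level p (suc M) (suc F) → parity M ≡ λ′ →
      (∀ {o′} → o′ + clipOdd (suc M) p ≡ n → Losing λ′ F o′) → IsN (Single k) p
    win-skip-> {M} j nonempty M<pj lv M≡λ′ losing = isN q p⟶q
      (proj₁ (ih sum-decreases (level-skip-> M<pj lv)) (losing-at M M≡λ′ (losing (clipOdd-skip-> M M<pj))))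
      where open Skipping j nonempty

    win-skip-tall : ∀ {M λ′} j → (∀ i → i ≢ j → 1 ≤ p i) → let L = suc (suc M) in L ≤ p j → Level p L 0 → parity M ≡ λ′ →
      (∀ {o′ T F} → 1 ≤ T → F + T + 1 ≡ k → o′ + clipOdd L p + T ≡ 2 * toℕ λ′ * T + n → Losing λ′ F o′) →
      IsN (Single k) p
    win-skip-tall {M} j nonempty L≤pj lv M≡λ′ losing with level-skip-tall M L≤pj lv
      where open Skipping j nonempty
    ... | F , F+T+1≡k , 1≤T , lv′ = isN q p⟶q (proj₁ (ih sum-decreases lv′) (losing-at M M≡λ′
      (losing 1≤T F+T+1≡k (subst (λ λ″ → _ ≡ 2 * toℕ λ″ * _ + n) M≡λ′ (clipOdd-skip-tall M L≤pj)))))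
      where open Skipping j nonempty

    losing-skip⇒N : ∀ {L F j q} → Skip j p q → Level p L F → Losing (parity L) F (clipOdd L p) → IsN (Single k) q
    losing-skip⇒N {zero} skip lv _ = contradiction lv (Descend.¬level-zero skip)
    losing-skip⇒N {suc M} {F} {j} {q} skip lv losing with p j ≤? M
    ... | yes pj≤M = proj₂ (ih sum-decreases (level-skip-≤ pj≤M lv))
      (¬losing-skip-≤ (parity M) {c = 2 * bit (p j)} losing′ (clipOdd-skip-≤ M pj≤M))
      where
      open SkipEffect skip
      open Descend skip
      losing′ : Losing (parity M ℙ.⁻¹) F (clipOdd (suc M) p)
      losing′ = subst (λ λ′ → Losing λ′ F (clipOdd (suc M) p)) (parity-suc M) losing
    ... | no pj≰M = beyond F M lv losing (≰⇒> pj≰M)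
      where
      open SkipEffect skip
      open Descend skip
      beyond : ∀ F M → Level p (suc M) F → Losing (parity (suc M)) F (clipOdd (suc M) p) → M < p j → IsN (Single k) q
      beyond (suc F) M lv losing M<pj = proj₂ (ih sum-decreases (level-skip-> M<pj lv))
        (¬losing-skip-> (parity M) (subst (λ λ′ → Losing λ′ (suc F) (clipOdd (suc M) p)) (parity-suc M) losing)
          (clipOdd-skip-> M M<pj) (clipOdd-pos M<pj))
      beyond zero zero lv _ 0<pj = contradiction (tall-bound 0 0<pj lv) (<-irrefl refl)
      beyond zero (suc M) lv losing M<pj with level-skip-tall M M<pj lv
      ... | F , F+T+1≡k , 1≤T , lv′ = proj₂ (ih sum-decreases lv′)
        (¬losing-skip-tall (parity M) losing 1≤T F+T+1≡k (clipOdd-skip-tall M M<pj))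

    losing⇒P : ∀ {L F} → Level p L F → Losing (parity L) F (clipOdd L p) → IsP (Single k) p
    losing⇒P lv losing = isP λ q p⟶q → let j , skip = move⇒skip p⟶q in losing-skip⇒N skip lv losing

    data Shape (M : ℕ) : Set where
      even-short  : ∀ j → (∀ i → i ≢ j → 1 ≤ p i) → p j ≤ M → bit (p j) ≡ 0 → Shape M
      odd-or-tall : (∀ i → 1 ≤ p i) → (∀ i → p i ≤ M → bit (p i) ≡ 1) → Shape M

    shape : ∀ {M F} → Level p (suc M) F → Shape M
    shape {M} lv with any? (λ i → p i ≟ 0)
    ... | yes (z , pz≡0) = even-short z (at-most-one-zero lv z pz≡0) (subst (_≤ M) (sym pz≡0) z≤n) (cong bit pz≡0)
    ... | no  no-zero = shape-nonempty (λ i → n≢0⇒n>0 (λ pi≡0 → no-zero (i , pi≡0)))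
      where
      shape-nonempty : (∀ i → 1 ≤ p i) → Shape M
      shape-nonempty nonempty with any? (λ j → (p j ≤? M) ×-dec (bit (p j) ≟ 0))
      ... | yes (j , pj≤M , even) = even-short j (λ i _ → nonempty i) pj≤M even
      ... | no  no-even = odd-or-tall nonempty λ i pi≤M → bit≢0⇒bit≡1 (p i) (λ even → no-even (i , pi≤M , even))

    win-even-tall : ∀ {M F} j → (∀ i → i ≢ j → 1 ≤ p i) → M < p j → Level p (suc M) F → parity M ≡ 1ℙ →
      F + 2 ≤ k → F + 2 ≤ clipOdd (suc M) p → IsN (Single k) p
    win-even-tall {M} {suc F} j nonempty M<pj lv M-odd F+3≤k F+3≤o =
      win-skip-> j nonempty M<pj lv M-odd (losing₁-> F+3≤k F+3≤o)
    win-even-tall {suc M} {zero} j nonempty M<pj lv M-odd _ 2≤o =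
      win-skip-tall j nonempty M<pj lv (parity-suc⁻¹ M M-odd) (losing₀-tall 2≤o)

    win-even : ∀ {M F} → Level p (suc M) F → parity M ≡ 1ℙ → F + 2 ≤ k → F + 2 ≤ clipOdd (suc M) p → IsN (Single k) p
    win-even {M} {F} lv M-odd F+2≤k F+2≤o with shape lv
    ... | even-short j nonempty pj≤M even = win-skip-≤ j nonempty pj≤M lv M-odd λ o′+o≡ →
      losing₁-≤ {c = 0} F+2≤k F+2≤o (trans o′+o≡ (cong (λ b → 2 * b + k) even))
    ... | odd-or-tall nonempty odd with any? (λ j → suc M ≤? p j)
    ...   | yes (j , M<pj) = win-even-tall j (λ i _ → nonempty i) M<pj lv M-odd F+2≤k F+2≤o
    ...   | no  none-tall = win-skip-≤ zero (λ i _ → nonempty i) (short zero) lv M-odd λ o′+o≡ →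
      losing₁-≤ {c = 2} F+2≤k (subst (2 + (F + 2) ≤_) (sym o≡n) (s≤s F+3≤k))
        (trans o′+o≡ (cong (λ b → 2 * b + k) (odd zero (short zero))))
      where
      short : ∀ i → p i ≤ M
      short i = ≤-pred (≰⇒> (λ M<pi → none-tall (i , M<pi)))
      o≡n : clipOdd (suc M) p ≡ n
      o≡n = sum-ones (λ i → bit-clip (odd i) (λ M<pi → contradiction (short i) (<⇒≱ M<pi)))
      F+3≤k : suc (F + 2) ≤ k
      F+3≤k = ≤∧≢⇒< F+2≤k (parity-n≡F⇒F+2≢k (trans (cong parity (sym o≡n)) (parity-clipOdd-suc lv M-odd)))

    win-odd-last : ∀ {M F} → Level p (suc M) F → parity M ≡ 0ℙ → F + 1 ≡ k → IsN (Single k) p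
    win-odd-last {M} {F} lv M-even F+1≡k with shape lv
    ... | even-short j nonempty pj≤M _ =
      win-skip-≤ j nonempty pj≤M lv M-even (losing₀-last {c = bit (p j)} F+1≡k (parity-clipOdd-suc lv M-even))
    ... | odd-or-tall nonempty odd with any? (λ j → p j ≤? M)
    ...   | yes (j , pj≤M) =
      win-skip-≤ j (λ i _ → nonempty i) pj≤M lv M-even
        (losing₀-last {c = bit (p j)} F+1≡k (parity-clipOdd-suc lv M-even))
    ...   | no  none-short =
      win-skip-> zero (λ i _ → nonempty i) (all-tall zero) lv′ M-even (losing₀-> M+2≤k o≡n)
      where
      all-tall : ∀ i → M < p i
      all-tall i = ≰⇒> (λ pi≤M → none-short (i , pi≤M))
      F≡1+M : F ≡ suc M
      F≡1+M = excess-all-tall lv all-tall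
      lv′ : Level p (suc M) (suc M)
      lv′ = subst (Level p (suc M)) F≡1+M lv
      M+2≤k : M + 2 ≤ k
      M+2≤k = ≤-reflexive (trans (+-comm M 2) (trans (+-comm 1 (suc M)) (trans (cong (_+ 1) (sym F≡1+M)) F+1≡k)))
      o≡n : clipOdd (suc M) p ≡ n
      o≡n = sum-ones (λ i → bit-clip (λ pi≤M → contradiction pi≤M (<⇒≱ (all-tall i)))
                                     (λ _ → cong toℕ (parity-suc-≡ M M-even)))

    win-odd-all-odd : ∀ {M F} → (∀ i → 1 ≤ p i) → (∀ i → p i ≤ M → bit (p i) ≡ 1) → Level p (suc M) F →
      parity M ≡ 0ℙ → F + 2 ≤ k → IsN (Single k) p
    win-odd-all-odd {M} {F} nonempty odd lv M-even F+2≤k = by-excess F lv F+2≤k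
      where
      o≡n : clipOdd (suc M) p ≡ n
      o≡n = sum-ones (λ i → bit-clip (odd i) (λ _ → cong toℕ (parity-suc-≡ M M-even)))
      by-excess : ∀ F → Level p (suc M) F → F + 2 ≤ k → IsN (Single k) p
      by-excess zero lv _ = contradiction (trans (cong parity (sym o≡n))
        (trans (parity-clipOdd-suc lv M-even) (ℙ.+-identityʳ (parity k)))) parity-n≢k
      by-excess (suc F) lv F+3≤k with p zero ≤? M
      ... | yes p₀≤M = win-skip-≤ zero (λ i _ → nonempty i) p₀≤M lv M-even λ o′+o≡ →
        losing₀-≤ {c = 2} F+3≤k (subst (λ o → 2 + k ≤ o + suc F) (sym o≡n) n+2≤n+F+1)
          (trans o′+o≡ (cong (λ b → 2 * b + k) (odd zero p₀≤M)))
        where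
        n+2≤n+F+1 : suc n ≤ n + suc F
        n+2≤n+F+1 = ≤-trans (s≤s (m≤m+n n F)) (≤-reflexive (sym (+-suc n F)))
      ... | no  p₀≰M = win-skip-> zero (λ i _ → nonempty i) (≰⇒> p₀≰M) lv M-even
        (losing₀-> (≤-trans (n≤1+n _) F+3≤k) o≡n)

    win-odd : ∀ {M F} → Level p (suc M) F → parity M ≡ 0ℙ → F + 2 ≤ k → k ≤ clipOdd (suc M) p + F → IsN (Single k) p
    win-odd {M} {F} lv M-even F+2≤k k≤o+F with shape lv
    ... | even-short j nonempty pj≤M even = win-skip-≤ j nonempty pj≤M lv M-even λ o′+o≡ →
      losing₀-≤ {c = 0} F+2≤k k≤o+F (trans o′+o≡ (cong (λ b → 2 * b + k) even))
    ... | odd-or-tall nonempty odd = win-odd-all-odd nonempty odd lv M-even F+2≤k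

    ¬losing⇒N : ∀ {L F} → Level p L F → ¬ Losing (parity L) F (clipOdd L p) → IsN (Single k) p
    ¬losing⇒N {zero} lv ¬losing =
      contradiction (subst₂ (Losing 0ℙ) (sym (level-zero lv)) (sym (clipOdd-zero p)) losing-origin) ¬losing
    ¬losing⇒N {suc M} {F} lv ¬losing with parity M in M≡
    ... | 1ℙ with ¬losing-even (excess<k lv) (parity-clipOdd-suc lv M≡)
                    (¬losing ∘ losing-at (suc M) (parity-suc-≡ M M≡))
    ...   | F+2≤k , F+2≤o = win-even lv M≡ F+2≤k F+2≤o
    ¬losing⇒N {suc M} {F} lv ¬losing | 0ℙ with ¬losing-odd (excess<k lv) (parity-clipOdd-suc lv M≡)
                                                (¬losing ∘ losing-at (suc M) (parity-suc-≡ M M≡))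
    ...   | inj₁ F+1≡k           = win-odd-last lv M≡ F+1≡k
    ...   | inj₂ (F+2≤k , k≤o+F) = win-odd lv M≡ F+2≤k k≤o+F

  classified : ∀ (p : Position n) → Classified p
  classified = WF.All.wfRec (On.wellFounded sum <-wellFounded) _ Classified
    λ p ih lv → let open Step p ih in losing⇒P lv , ¬losing⇒N lv

  -- A move lowers Σ by k and each stack by at most one, so k·pᵢ − Σ p never decreases.
  reach-bound : ∀ {p t : Position n} → Reachable (Single k) p t → ∀ i → sum t + k * p i ≤ sum p + k * t i
  reach-bound ε i = ≤-refl
  reach-bound {p} {t} (_◅_ {j = q} p⟶q q⟶*t) i with move⇒skip p⟶q
  ... | j , skip = begin
    sum t + k * p i          ≤⟨ +-monoʳ-≤ (sum t) (*-monoʳ-≤ k (skip-≤ i)) ⟩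
    sum t + k * suc (q i)    ≡⟨ shuffle (sum t) k (q i) ⟩
    sum t + k * q i + k      ≤⟨ +-monoˡ-≤ k (reach-bound q⟶*t i) ⟩
    sum q + k * t i + k      ≡⟨ shuffle′ (sum q) (k * t i) k ⟩
    sum q + k + k * t i      ≡⟨ cong (_+ k * t i) sum-skip ⟩
    sum p + k * t i          ∎
    where
    open ≤-Reasoning
    open SkipEffect skip
    shuffle : ∀ a b c → a + b * suc c ≡ a + b * c + b
    shuffle = solve-∀
    shuffle′ : ∀ a b c → a + b + c ≡ a + c + b
    shuffle′ = solve-∀

  reduced-bound : ∀ {p} → Reduced (Single k) p → ∀ i → k * p i ≤ sum p
  reduced-bound {p} reduced i with reduced i
  ... | t , p⟶*t , _ , ti≡0 = ≤-trans (m≤n+m (k * p i) (sum t)) (begin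
    sum t + k * p i   ≤⟨ reach-bound p⟶*t i ⟩
    sum p + k * t i   ≡⟨ cong (λ x → sum p + k * x) ti≡0 ⟩
    sum p + k * 0     ≡⟨ cong (sum p +_) (*-zeroʳ k) ⟩
    sum p + 0         ≡⟨ +-identityʳ (sum p) ⟩
    sum p             ∎)
    where open ≤-Reasoning

  module Reduced-level {p : Position n} (bound : ∀ i → k * p i ≤ sum p) where
    L F : ℕ
    L = sum p / k
    F = sum p % k

    sum≡ : sum p ≡ k * L + F
    sum≡ = trans (m≡m%n+[m/n]*n (sum p) k) (trans (+-comm F (L * k)) (cong (_+ F) (*-comm L k)))

    sum< : sum p < k * suc L
    sum< = begin-strict
      sum p        ≡⟨ sum≡ ⟩
      k * L + F    <⟨ +-monoʳ-< (k * L) (m%n<n (sum p) k) ⟩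
      k * L + k    ≡⟨ +-comm (k * L) k ⟩
      k + k * L    ≡⟨ *-suc k L ⟨
      k * suc L    ∎
      where open ≤-Reasoning

    short : ∀ i → p i ≤ L
    short i = ≮⇒≥ λ L<pi → <-irrefl refl (<-≤-trans sum< (≤-trans (*-monoʳ-≤ k L<pi) (bound i)))

    clip≡sum : ∀ {L′} → L ≤ L′ → clip L′ p ≡ sum p
    clip≡sum L≤L′ = sum-cong-≗ (λ i → m≤n⇒m⊓n≡m (≤-trans (short i) L≤L′))

    level-reduced : Level p L F
    level-reduced = level (trans (clip≡sum ≤-refl) sum≡) (subst (_< k * suc L) (sym (clip≡sum (n≤1+n L))) sum<)

    clipOdd≡oddCount : clipOdd L p ≡ oddCount p
    clipOdd≡oddCount = trans (sum-cong-≗ (λ i → cong bit (m≤n⇒m⊓n≡m (short i)))) (sym (oddCount≡sum-bit p))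

    F+k*bitL<2k : F + k * bit L < 2 * k
    F+k*bitL<2k = begin-strict
      F + k * bit L    <⟨ +-monoˡ-< (k * bit L) (m%n<n (sum p) k) ⟩
      k + k * bit L    ≤⟨ +-monoʳ-≤ k (≤-trans (*-monoʳ-≤ k (bit≤1 L)) (≤-reflexive (*-identityʳ k))) ⟩
      k + k            ≡⟨ cong (k +_) (+-identityʳ k) ⟨
      2 * k            ∎
      where open ≤-Reasoning

    sOf≡ : sOf k p ≡ F + k * bit L
    sOf≡ = begin
      Σp p % (2 * k)                              ≡⟨ cong (_% (2 * k)) (Σp≡sum p) ⟩
      sum p % (2 * k)                             ≡⟨ cong (_% (2 * k)) sum≡′ ⟩
      (F + k * bit L + L / 2 * (2 * k)) % (2 * k) ≡⟨ [m+kn]%n≡m%n (F + k * bit L) (L / 2) (2 * k) ⟩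
      (F + k * bit L) % (2 * k)                   ≡⟨ m<n⇒m%n≡m F+k*bitL<2k ⟩
      F + k * bit L                               ∎
      where
      open ≡-Reasoning
      shuffle : ∀ a b c d → a * (b + c * 2) + d ≡ d + a * b + c * (2 * a)
      shuffle = solve-∀
      sum≡′ : sum p ≡ F + k * bit L + L / 2 * (2 * k)
      sum≡′ = trans sum≡ (trans (cong (λ x → k * x + F) (trans (m≡m%n+[m/n]*n L 2) (cong (_+ L / 2 * 2) (%2≡bit L))))
                (shuffle k (bit L) (L / 2) F))

  PSet : ℕ → ℕ → Set
  PSet s o = S₁ k s o ⊎ S₂ n s o ⊎ S₃ k s o

  private
    F<m⇒F+2≤k : ∀ {F} → F < m → F + 2 ≤ k
    F<m⇒F+2≤k {F} F<m = subst (_≤ k) (+-comm 2 F) (s≤s F<m)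

    F+2≤k⇒F<m : ∀ {F} → F + 2 ≤ k → F < m
    F+2≤k⇒F<m {F} F+2≤k = ≤-pred (subst (_≤ k) (+-comm F 2) F+2≤k)

    %2≡⇒parity≡ : ∀ {x y} → x % 2 ≡ y % 2 → parity x ≡ parity y
    %2≡⇒parity≡ {x} {y} x≡y = toℕ-injective (trans (sym (%2≡bit x)) (trans x≡y (%2≡bit y)))

  losing⇒PSet : ∀ λ′ {F o} → (F + k * toℕ λ′) % 2 ≡ o % 2 → Losing λ′ F o → PSet (F + k * toℕ λ′) o
  losing⇒PSet 0ℙ {F} {o} s≡o losing = subst (λ s → PSet s o) (sym s≡F) (by-branch losing)
    where
    s≡F : F + k * 0 ≡ F
    s≡F = trans (cong (F +_) (*-zeroʳ k)) (+-identityʳ F)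
    by-branch : Losing 0ℙ F o → PSet F o
    by-branch (inj₁ (F+2≤k , o≤F)) = inj₁ (subst (λ s → s % 2 ≡ o % 2) s≡F s≡o , F+2≤k⇒F<m F+2≤k , o≤F)
    by-branch (inj₂ (F+1≡k , o≡n)) = inj₂ (inj₁ (suc-injective (trans (+-comm 1 F) F+1≡k) ,
      trans (%2≡bit o) (trans (cong toℕ o≡n) (sym (%2≡bit n)))))
  losing⇒PSet 1ℙ {F} {o} s≡o (F+2≤k , o+F+2≤k) = inj₂ (inj₂ (s≡o , m<s , s<2k-1 , o≤2m-s))
    where
    s≡F+k : F + k * 1 ≡ F + k
    s≡F+k = cong (F +_) (*-identityʳ k)
    m<s : m < F + k * 1
    m<s = subst (m <_) (sym s≡F+k) (m≤n+m k F)
    s<2k-1 : F + k * 1 < 2 * k ∸ 1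
    s<2k-1 = subst₂ _<_ (sym s≡F+k) (cong (m +_) (sym (+-identityʳ k))) (+-monoˡ-< k (F+2≤k⇒F<m F+2≤k))
    o≤2m-s : o ≤ 2 * (k ∸ 1) ∸ (F + k * 1)
    o≤2m-s = m+n≤o⇒m≤o∸n o (begin
      o + (F + k * 1)    ≡⟨ shuffle o F m ⟩
      suc (o + F) + m    ≤⟨ +-monoˡ-≤ m (≤-pred (subst (_≤ k) (shuffle′ o F) o+F+2≤k)) ⟩
      m + m              ≡⟨ cong (m +_) (+-identityʳ m) ⟨
      2 * (k ∸ 1)        ∎)
      where
      open ≤-Reasoning
      shuffle : ∀ a b c → a + (b + suc c * 1) ≡ suc (a + b) + c
      shuffle = solve-∀
      shuffle′ : ∀ a b → a + b + 2 ≡ suc (suc (a + b))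
      shuffle′ = solve-∀

  PSet⇒losing : ∀ λ′ {F o} → F < k → PSet (F + k * toℕ λ′) o → Losing λ′ F o
  PSet⇒losing 0ℙ {F} {o} F<k ps = by-set (subst (λ s → PSet s o) s≡F ps)
    where
    s≡F : F + k * 0 ≡ F
    s≡F = trans (cong (F +_) (*-zeroʳ k)) (+-identityʳ F)
    by-set : PSet F o → Losing 0ℙ F o
    by-set (inj₁ (_ , F<m , o≤F))           = inj₁ (F<m⇒F+2≤k F<m , o≤F)
    by-set (inj₂ (inj₁ (F≡m , o≡n)))        = inj₂ (trans (+-comm F 1) (cong suc F≡m) , %2≡⇒parity≡ {o} {n} o≡n)
    by-set (inj₂ (inj₂ (_ , m<F , _ , _)))  = contradiction (≤-pred F<k) (<⇒≱ m<F)
  PSet⇒losing 1ℙ {F} {o} F<k ps = by-set (subst (λ s → PSet s o) s≡F+k ps)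
    where
    s≡F+k : F + k * 1 ≡ F + k
    s≡F+k = cong (F +_) (*-identityʳ k)
    m<F+k : m < F + k
    m<F+k = m≤n+m k F
    by-set : PSet (F + k) o → Losing 1ℙ F o
    by-set (inj₁ (_ , F+k<m , _))             = contradiction (<-trans m<F+k F+k<m) (<-irrefl refl)
    by-set (inj₂ (inj₁ (F+k≡m , _)))          = contradiction (sym F+k≡m) (<⇒≢ m<F+k)
    by-set (inj₂ (inj₂ (_ , _ , F+k<2k-1 , o≤2m-s))) = F<m⇒F+2≤k F<m , o+F+2≤k
      where
      F<m : F < m
      F<m = +-cancelʳ-< k F m (subst (F + k <_) (cong (m +_) (+-identityʳ k)) F+k<2k-1)
      2m≡m+m : 2 * (k ∸ 1) ≡ m + m
      2m≡m+m = cong (m +_) (+-identityʳ m)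
      F+k≤2m : F + k ≤ 2 * (k ∸ 1)
      F+k≤2m = begin
        F + suc m   ≡⟨ +-suc F m ⟩
        suc F + m   ≤⟨ +-monoˡ-≤ m F<m ⟩
        m + m       ≡⟨ 2m≡m+m ⟨
        2 * (k ∸ 1) ∎
        where open ≤-Reasoning
      o+F+2≤k : o + F + 2 ≤ k
      o+F+2≤k = subst (_≤ k) (shuffle o F) (s≤s (+-cancelʳ-≤ m _ _ (begin
        suc (o + F) + m        ≡⟨ shuffle′ o F m ⟩
        o + (F + k)            ≤⟨ m≤o∸n⇒m+n≤o o F+k≤2m o≤2m-s ⟩
        2 * (k ∸ 1)            ≡⟨ 2m≡m+m ⟩
        m + m                  ∎)))
        where
        open ≤-Reasoning
        shuffle : ∀ a b → suc (suc (a + b)) ≡ a + b + 2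
        shuffle = solve-∀
        shuffle′ : ∀ a b c → suc (a + b) + c ≡ a + (b + suc c)
        shuffle′ = solve-∀

  sOf-parity : ∀ (p : Position n) → sOf k p % 2 ≡ oddCount p % 2
  sOf-parity p = begin
    Σp p % (2 * k) % 2        ≡⟨ m∣n⇒o%n%m≡o%m 2 (2 * k) (Σp p) (divides k (*-comm 2 k)) ⟩
    Σp p % 2                  ≡⟨ cong (_% 2) (Σp≡sum p) ⟩
    sum p % 2                 ≡⟨ %2≡bit (sum p) ⟩
    toℕ (parity (sum p))      ≡⟨ cong toℕ (parity-sum-bit p) ⟨
    bit (sum (bit ∘ p))       ≡⟨ %2≡bit (sum (bit ∘ p)) ⟨
    sum (bit ∘ p) % 2         ≡⟨ cong (_% 2) (oddCount≡sum-bit p) ⟨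
    oddCount p % 2            ∎
    where open ≡-Reasoning

  reduced-classification : ∀ (p : Position n) → Reduced (Single k) p →
    IsP (Single k) p ⇔ PSet (sOf k p) (oddCount p)
  reduced-classification p reduced = mk⇔ to from
    where
    open Reduced-level (reduced-bound reduced)
    o : ℕ
    o = clipOdd L p
    s≡o : (F + k * bit L) % 2 ≡ o % 2
    s≡o = subst₂ (λ s o → s % 2 ≡ o % 2) sOf≡ (sym clipOdd≡oddCount) (sOf-parity p)
    to : IsP (Single k) p → PSet (sOf k p) (oddCount p)
    to isp with losing? (parity L) F o
    ... | yes losing = subst₂ PSet (sym sOf≡) clipOdd≡oddCount (losing⇒PSet (parity L) s≡o losing)
    ... | no ¬losing = contradiction (proj₂ (classified p level-reduced) ¬losing) (P⇒¬N isp)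
    from : PSet (sOf k p) (oddCount p) → IsP (Single k) p
    from ps = proj₁ (classified p level-reduced)
      (PSet⇒losing (parity L) (m%n<n (sum p) k) (subst₂ PSet sOf≡ (sym clipOdd≡oddCount) ps))

theorem4 : (n : ℕ) → 2 ≤ n →
    let k = n ∸ 1 in
    ((p : Position n) → (sOf k p) % 2 ≡ oddCount p % 2)
    × ((p : Position n) → Reduced (Single k) p →
        (IsP (Single k) p ⇔
          (S₁ k (sOf k p) (oddCount p)
           ⊎ S₂ n (sOf k p) (oddCount p)
           ⊎ S₃ k (sOf k p) (oddCount p))))
theorem4 (suc (suc m)) (s≤s (s≤s z≤n)) = sOf-parity , reduced-classification
  where open Classification m
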